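{- Let $\phi=(\sqrt5+1)/2$. There is a constant $c<2$ such that the following holds for weight-biased leftist heaps and also for rank-biased leftist heaps: there exist sequences of operations (starting from heaps obtained from $\mathrm{empty}$ and $\mathrm{single}$ and applying $\mathrm{union}$, $\mathrm{delmin}$, etc. to previously obtained heaps) in which the heaps get arbitrarily large and in which the actual costs satisfy: $\mathrm{empty}$, $\mathrm{isEmpty}(x)$, $\mathrm{min}(x)$ and $\mathrm{single}(a)$ cost $0$, every $\mathrm{delmin}(x)$ costs at least $\log_\phi|x|-c$, and every $\mathrm{union}(x,y)$ costs at least $\log_\phi(|x|+|y|)-c$.
   Context: Binary trees with labels from a totally ordered set $A$: $\langle\rangle$ is the empty tree, $\langle t,a,u\rangle$ has left subtree $t$, root label $a$, right subtree $u$; $\langle a\rangle=\langle\langle\rangle,a,\langle\rangle\rangle$. Weight: $\#\langle\rangle=0$, $\#\langle t,a,u\rangle=\#t+\#u+1$; $|x|=\#x+1$. Rank: $\mathrm{rank}\langle\rangle=0$, $\mathrm{rank}\langle t,a,u\rangle=\mathrm{rank}\,u+1$. A heap satisfies the heap property (every label is $\le$ all labels in its subtrees); it is weight-biased if $\#t\ge\#u$ at every node $\langle t,a,u\rangle$, and rank-biased if $\mathrm{rank}\,t\ge\mathrm{rank}\,u$ at every node. Operations: $\mathrm{empty}=\langle\rangle$; $\mathrm{isEmpty}(x)$ tests $x=\langle\rangle$; $\mathrm{single}(a)=\langle a\rangle$; $\mathrm{min}(\langle\rangle)=\infty$ (larger than all labels), $\mathrm{min}\langle t,a,u\rangle=a$;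 $\mathrm{union}(x,y)=x\oplus y$; $\mathrm{delmin}\langle t,a,u\rangle=t\oplus u$. Meld: $\langle\rangle\oplus\langle\rangle=\langle\rangle$; $\langle t,a,u\rangle\oplus y=\mathrm{bal}\langle t,a,u\oplus y\rangle$ if $a\le\mathrm{min}(y)$; otherwise $x\oplus\langle t,a,u\rangle=\mathrm{bal}\langle t,a,x\oplus u\rangle$. For weight-biased heaps $\mathrm{bal}\langle t,a,u\rangle=\langle t,a,u\rangle$ if $\#t>\#u$ and $\langle u,a,t\rangle$ if $\#t\le\#u$; for rank-biased heaps $\mathrm{bal}\langle t,a,u\rangle=\langle t,a,u\rangle$ if $\mathrm{rank}\,t>\mathrm{rank}\,u$ and $\langle u,a,t\rangle$ if $\mathrm{rank}\,t\le\mathrm{rank}\,u$. Actual cost counts comparisons $a\le\mathrm{min}(y)$ made while unfolding $\oplus$, including comparisons with $\infty$: $T_\oplus(\langle\rangle,\langle\rangle)=0$, otherwise $T_\oplus(x,y)=1+T_\oplus$ of the recursive call. So $\mathrm{union}(x,y)$ costs $T_\oplus(x,y)$, $\mathrm{delmin}\langle t,a,u\rangle$ costs $T_\oplus(t,u)$, and the other operations cost $0$. -}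

module Defs where

open import Data.Nat using (ℕ; zero; suc; _+_; _*_; _∸_; _^_; _≤_; _<ᵇ_; _≤ᵇ_)
open import Data.Integer using (ℤ; +_; -[1+_])
import Data.Integer as ℤ
open import Data.Rational using (ℚ; ↥_; ↧ₙ_)
open import Data.Bool using (Bool; true; false; if_then_else_)
open import Data.Product using (_×_; _,_; ∃; ∃-syntax; Σ-syntax)
open import Data.List using (List; []; _∷_)
open import Data.List.Membership.Propositional using (_∈_)
open import Relation.Binary.PropositionalEquality using (_≡_)

data Tree : Set where
  leaf : Tree
  node : Tree → ℕ → Tree → Tree

weight : Tree → ℕ
weight leaf = 0
weight (node t a u) = weight t + weight u + 1

size : Tree → ℕ
size x = suc (weight x)

rank : Tree → ℕ
rank leaf = 0
rank (node t a u) = suc (rank u)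

-- test  a ≤ min(y), where min ⟨⟩ = ∞
le-min : ℕ → Tree → Bool
le-min a leaf = true
le-min a (node _ b _) = a ≤ᵇ b

-- bal with respect to a measure m (weight for weight-biased, rank for rank-biased):
-- bal⟨t,a,u⟩ = ⟨t,a,u⟩ if m t > m u, and ⟨u,a,t⟩ if m t ≤ m u.
bal : (Tree → ℕ) → Tree → ℕ → Tree → Tree
bal m t a u = if m u <ᵇ m t then node t a u else node u a t

-- meld x ⊕ y, together with its actual cost T⊕(x,y) (number of comparisons).
meldC : (Tree → ℕ) → Tree → Tree → Tree × ℕ
meldC m leaf leaf = leaf , 0
meldC m (node t a u) y with le-min a y
... | true  with meldC m u y
...   | r , k = bal m t a r , suc k
meldC m (node t a u) (node t' b u') | false with meldC m (node t a u) u'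
...   | r , k = bal m t' b r , suc k
meldC m (node t a u) leaf | false = leaf , 0   -- impossible: a ≤ ∞ always holds
meldC m leaf (node t b u) with meldC m leaf u
... | r , k = bal m t b r , suc k

meld : (Tree → ℕ) → Tree → Tree → Tree
meld m x y = Data.Product.proj₁ (meldC m x y)
  where import Data.Product

meldCost : (Tree → ℕ) → Tree → Tree → ℕ
meldCost m x y = Data.Product.proj₂ (meldC m x y)
  where import Data.Product

-- Powers of φ = (1+√5)/2 with natural exponent, as a + bφ (a, b ∈ ℕ):
-- φ⁰ = 1 + 0φ,  φ·(a + bφ) = b + (a+b)φ  (using φ² = φ + 1).
φpow : ℕ → ℕ × ℕ
φpow zero = 1 , 0
φpow (suc e) with φpow e
... | a , b = b , a + b

-- LeφPow n E  ⇔  (n : ℝ) ≤ φ^E  for n ∈ ℕ, E ∈ ℤ.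
-- For E ≥ 0, φ^E = a + bφ and  n ≤ a + b(1+√5)/2  ⇔  2n − 2a − b ≤ b√5
--   ⇔  (2n ∸ (2a+b))² ≤ 5b².
-- For E < 0, 0 < φ^E < 1, so n ≤ φ^E ⇔ n = 0.
LeφPow : ℕ → ℤ → Set
LeφPow n (+ e) with φpow e
... | a , b = ((2 * n) ∸ (2 * a + b)) ^ 2 ≤ 5 * (b ^ 2)
LeφPow n -[1+ e ] = n ≡ 0

-- CostOK c n k  ⇔  k ≥ log_φ n − c  (for n ≥ 1, c = p/q with q > 0)
--   ⇔ q·k + p ≥ q·log_φ n  ⇔  n^q ≤ φ^(q·k + p).
CostOK : ℚ → ℕ → ℕ → Set
CostOK c n k = LeφPow (n ^ ↧ₙ c) (+ (↧ₙ c * k) ℤ.+ ↥ c)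

-- GoodRun m c hs : the list hs (newest first) consists of all heaps produced by a
-- sequence of operations (with meld w.r.t. measure m), each applied to previously
-- produced heaps, in which every union(x,y) costs ≥ log_φ(|x|+|y|) − c and every
-- delmin(x) costs ≥ log_φ|x| − c.  (empty, single, isEmpty, min cost 0 and
-- isEmpty/min produce no heaps, so they impose no constraint.)
data GoodRun (m : Tree → ℕ) (c : ℚ) : List Tree → Set where
  start  : GoodRun m c []
  empty  : ∀ {hs} → GoodRun m c hs → GoodRun m c (leaf ∷ hs)
  single : ∀ {hs} → GoodRun m c hs → (a : ℕ) → GoodRun m c (node leaf a leaf ∷ hs)
  union  : ∀ {hs x y} → GoodRun m c hs → x ∈ hs → y ∈ hs →
           CostOK c (size x + size y) (meldCost m x y) →
           GoodRun m c (meld m x y ∷ hs)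
  delmin : ∀ {hs t a u} → GoodRun m c hs → node t a u ∈ hs →
           CostOK c (size (node t a u)) (meldCost m t u) →
           GoodRun m c (meld m t u ∷ hs)

ArbitrarilyLarge : (Tree → ℕ) → ℚ → Set
ArbitrarilyLarge m c = (N : ℕ) → ∃[ hs ] (GoodRun m c hs × ∃[ x ] (x ∈ hs × N ≤ size x))

{-# OPTIONS --safe #-}
module Submission where

-- Melding walks down both right spines to their ends (the comparisons with ∞ included), so
-- union x y costs rank x + rank y, whichever balance criterion is used.  Write T₂, T₃, T₄, …
-- for the trees Fibʳ 2, Fibˡ 3, Fibʳ 4, Fibˡ 5, … below: Fibonacci trees with one extra node,
-- T_k of size F(k) + 1, with T₂ a single node and T₃ the meld of two of them.  If the labels on
-- the right spines of T_(k+1) and T_k alternate, meld merges the spines in alternation and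
-- every rebalancing step swaps, both for weight and for rank, so that meld T_(k+1) T_k is
-- again T_(k+2).  This union costs k, while log_φ (F(k+2) + 2) ≤ k + 3/2 because
-- F(k+2) ≈ φ^(k+2)/√5.  Labels that make the spines alternate at every stage are handed out
-- top-down from a strictly increasing sequence.

open import Defs
open import Data.Rational using (ℚ; _<_; _/_)
open import Data.Integer using (+_)
open import Data.Product using (_×_; ∃-syntax)

open import Data.Bool using (true; false; T)
open import Data.Empty using (⊥-elim)
open import Data.Integer using (+<+)
open import Data.List using (List; _∷_)
open import Data.List.Membership.Propositional using (_∈_)
open import Data.List.Relation.Binary.Subset.Propositional using (_⊆_)
open import Data.List.Relation.Unary.Any using (here; there)
open import Data.Nat
  using ( ℕ; zero; suc; _+_; _*_; _∸_; _^_; _≤_; _≤′_; ≤′-refl; ≤′-step; z≤n; s≤s; s≤s⁻¹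
        ; _≤ᵇ_; _<ᵇ_; ⌊_/2⌋)
  renaming (_<_ to _<ℕ_)
open import Data.Nat.Properties
open import Data.Nat.Tactic.RingSolver using (solve-∀)
open import Data.Product using (_,_; proj₁; proj₂)
open import Data.Rational using (*<*)
open import Data.Unit using (tt)
open import Function using (_∘_; id)
open import Relation.Binary.Core using (_Preserves_⟶_)
open import Relation.Binary.PropositionalEquality
open import Relation.Unary using (_∩_)

-- Fibonacci numbers and powers of φ

fib : ℕ → ℕ
fib 0 = 0
fib 1 = 1
fib (suc (suc n)) = fib n + fib (suc n)

fib-≤-suc : ∀ n → fib n ≤ fib (suc n)
fib-≤-suc zero    = z≤n
fib-≤-suc (suc n) = m≤n+m (fib (suc n)) (fib n)

fib-mono : ∀ {m n} → m ≤ n → fib m ≤ fib n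
fib-mono m≤n = go (≤⇒≤′ m≤n)
  where
    go : ∀ {m n} → m ≤′ n → fib m ≤ fib n
    go ≤′-refl                    = ≤-refl
    go {n = suc n} (≤′-step m≤n) = ≤-trans (go m≤n) (fib-≤-suc n)

fib-add : ∀ m n → fib (suc (m + n)) ≡ fib (suc m) * fib (suc n) + fib m * fib n
fib-add zero    n = sym (trans (+-identityʳ _) (*-identityˡ _))
fib-add (suc m) n = begin
  fib (suc (suc (m + n)))                                   ≡⟨ cong (fib ∘ suc) (+-suc m n) ⟨
  fib (suc (m + suc n))                                     ≡⟨ fib-add m (suc n) ⟩
  fib (suc m) * (fib n + fib (suc n)) + fib m * fib (suc n) ≡⟨ regroup (fib m) (fib (suc m)) (fib n) (fib (suc n)) ⟩
  (fib m + fib (suc m)) * fib (suc n) + fib (suc m) * fib n ∎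
  where
    open ≡-Reasoning
    regroup : ∀ a b u v → b * (u + v) + a * v ≡ (a + b) * v + b * u
    regroup = solve-∀

φpow-fib : ∀ e → φpow (suc e) ≡ (fib e , fib (suc e))
φpow-fib zero    = refl
φpow-fib (suc e) = cong (λ p → proj₂ p , proj₁ p + proj₂ p) (φpow-fib e)

-- Since φ ≥ 3/2, 2n ≤ 2a + 3b gives n ≤ a + bφ, which LeφPow encodes in this form.
≤a+bφ : ∀ n a b → 2 * n ≤ 2 * a + 3 * b → (2 * n ∸ (2 * a + b)) ^ 2 ≤ 5 * b ^ 2
≤a+bφ n a b 2n≤ = begin
  (2 * n ∸ (2 * a + b)) ^ 2 ≤⟨ ^-monoˡ-≤ 2 (m≤n+o⇒m∸n≤o (2 * n) (2 * a + b) 2n≤2a+b+2b) ⟩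
  (2 * b) ^ 2               ≡⟨ square b ⟩
  4 * b ^ 2                 ≤⟨ *-monoˡ-≤ (b ^ 2) (n≤1+n 4) ⟩
  5 * b ^ 2                 ∎
  where
    open ≤-Reasoning
    -- the ring solver needs _ ^ 2 unfolded to _ * (_ * 1), here and in square-bound
    split : ∀ x y → 2 * x + 3 * y ≡ (2 * x + y) + 2 * y
    split = solve-∀
    2n≤2a+b+2b : 2 * n ≤ (2 * a + b) + 2 * b
    2n≤2a+b+2b = ≤-trans 2n≤ (≤-reflexive (split a b))
    square : ∀ y → (2 * y) * (2 * y * 1) ≡ 4 * (y * (y * 1))
    square = solve-∀

≤φpow : ∀ n e → 2 * n ≤ 2 * proj₁ (φpow e) + 3 * proj₂ (φpow e) → LeφPow n (+ e)
≤φpow n e with φpow e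
... | a , b = ≤a+bφ n a b

-- With c = 3/2, CostOK c N k unfolds to LeφPow (N ^ 2) (+ (2 * k + 3)), that is N² ≤ φ^(2k+3).
c : ℚ
c = + 3 / 2

c<2 : c < + 2 / 1
c<2 = *<* (+<+ (n<1+n 3))

-- With G = 2 + u and H = 3 + v, the right side minus the left is a polynomial in u, v with
-- nonnegative coefficients.
square-bound : ∀ {G H} → 2 ≤ G → 3 ≤ H → 2 * (H + 2) ^ 2 ≤ 2 * (G * H) + 3 * (H * H + G * G)
square-bound {suc (suc u)} {suc (suc (suc v))} (s≤s (s≤s _)) (s≤s (s≤s (s≤s _))) =
  ≤-trans (m≤m+n _ _) (≤-reflexive (expand u v))
  where
    expand : ∀ u v → 2 * ((3 + v + 2) * ((3 + v + 2) * 1))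
                       + (1 + 2 * v + 18 * u + v * v + 2 * (u * v) + 3 * (u * u))
                   ≡ 2 * ((2 + u) * (3 + v)) + 3 * ((3 + v) * (3 + v) + (2 + u) * (2 + u))
    expand = solve-∀

fib-cost : ∀ k → CostOK c (fib (4 + k) + 2) (2 + k)
fib-cost k = subst (LeφPow ((H + 2) ^ 2)) (cong +_ (exponent k)) (≤φpow ((H + 2) ^ 2) (suc e) bound)
  where
    G = fib (3 + k)
    H = fib (4 + k)
    e = (3 + k) + (3 + k)
    exponent : ∀ i → suc ((3 + i) + (3 + i)) ≡ 2 * (2 + i) + 3
    exponent = solve-∀
    bound : 2 * (H + 2) ^ 2 ≤ 2 * proj₁ (φpow (suc e)) + 3 * proj₂ (φpow (suc e))
    bound = begin
      2 * (H + 2) ^ 2                                     ≤⟨ square-bound {G} {H} (fib-mono (m≤m+n 3 k))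
                                                                                  (fib-mono (m≤m+n 4 k)) ⟩
      2 * (G * H) + 3 * (H * H + G * G)                   ≤⟨ +-monoˡ-≤ _ (*-monoʳ-≤ 2 (m≤m+n (G * H) _)) ⟩
      2 * (G * H + fib (2 + k) * G) + 3 * (H * H + G * G) ≡⟨ cong₂ (λ u v → 2 * u + 3 * v)
                                                                    (fib-add (2 + k) (3 + k)) (fib-add (3 + k) (3 + k)) ⟨
      2 * fib e + 3 * fib (suc e)                         ≡⟨ cong (λ p → 2 * proj₁ p + 3 * proj₂ p) (φpow-fib e) ⟨
      2 * proj₁ (φpow (suc e)) + 3 * proj₂ (φpow (suc e)) ∎
      where open ≤-Reasoning

-- Melding

meldCost≡rank+rank : ∀ m x y → meldCost m x y ≡ rank x + rank y
meldCost≡rank+rank m leaf leaf         = refl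
meldCost≡rank+rank m leaf (node _ _ u) = cong suc (meldCost≡rank+rank m leaf u)
meldCost≡rank+rank m (node t a u)      = node-case
  where
    node-case : ∀ y → meldCost m (node t a u) y ≡ suc (rank u) + rank y
    node-case leaf = cong suc (meldCost≡rank+rank m u leaf)
    node-case (node t′ b u′) with a ≤ᵇ b
    ... | true  = cong suc (meldCost≡rank+rank m u (node t′ b u′))
    ... | false = trans (cong suc (node-case u′)) (sym (+-suc _ (rank u′)))

rank≤weight : ∀ t → rank t ≤ weight t
rank≤weight leaf         = z≤n
rank≤weight (node l a r) = begin
  suc (rank r)              ≤⟨ s≤s (≤-trans (rank≤weight r) (m≤n+m (weight r) (weight l))) ⟩
  suc (weight l + weight r) ≡⟨ +-comm 1 _ ⟩
  weight l + weight r + 1   ∎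
  where open ≤-Reasoning

size-node : ∀ l a r → size (node l a r) ≡ size l + size r
size-node l a r = sym (trans (+-suc (suc (weight l)) (weight r)) (cong suc (+-comm 1 _)))

data Spine : Tree → (ℕ → ℕ) → Set where
  leaf : ∀ {σ} → Spine leaf σ
  node : ∀ {l r σ} → Spine r (σ ∘ suc) → Spine (node l (σ 0) r) σ

spine-tail : ∀ {l a r σ} → Spine (node l a r) σ → Spine r (σ ∘ suc)
spine-tail (node sr) = sr

Interleave : (ℕ → ℕ) → (ℕ → ℕ) → Set
Interleave σ τ = ∀ i → σ i <ℕ τ i × τ i <ℕ σ (suc i)

interleave-swap : ∀ {σ τ} → Interleave σ τ → Interleave τ (σ ∘ suc)
interleave-swap I i = proj₂ (I i) , proj₁ (I (suc i))

interleave-tail : ∀ {σ τ} → Interleave σ τ → Interleave (σ ∘ suc) (τ ∘ suc)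
interleave-tail I = I ∘ suc

spines-le-min : ∀ {l a r t σ τ} → Spine (node l a r) σ → Spine t τ → σ 0 <ℕ τ 0 → T (le-min a t)
spines-le-min (node _) leaf     _     = tt
spines-le-min (node _) (node _) σ₀<τ₀ = ≤⇒≤ᵇ (<⇒≤ σ₀<τ₀)

module _ (m : Tree → ℕ) where

  meld-root : ∀ {l a r y} → T (le-min a y) → meld m (node l a r) y ≡ bal m l a (meld m r y)
  meld-root {a = a} {y = y} a≤y with le-min a y | a≤y
  ... | true | _ = refl

  meld-> : ∀ {l a r l′ b r′} → b <ℕ a →
           meld m (node l a r) (node l′ b r′) ≡ bal m l′ b (meld m (node l a r) r′)
  meld-> {a = a} {b = b} b<a with a ≤ᵇ b | ≤ᵇ⇒≤ a b
  ... | false | _   = refl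
  ... | true  | a≤b = ⊥-elim (<⇒≱ b<a (a≤b tt))

  bal-swap : ∀ {l a r} → m l ≤ m r → bal m l a r ≡ node r a l
  bal-swap {l} {r = r} l≤r with m r <ᵇ m l | <ᵇ⇒< (m r) (m l)
  ... | false | _   = refl
  ... | true  | r<l = ⊥-elim (<⇒≱ (r<l tt) l≤r)

  root-stays : ∀ {l a r y t} → T (le-min a y) → meld m r y ≡ t → m l ≤ m t →
               meld m (node l a r) y ≡ node t a l
  root-stays {l} {a} {r} a≤y refl l≤t = trans (meld-root {l} {a} {r} a≤y) (bal-swap l≤t)

  meld-leaf-comm : ∀ y → meld m leaf y ≡ meld m y leaf
  meld-leaf-comm leaf         = refl
  meld-leaf-comm (node l b r) = cong (bal m l b) (meld-leaf-comm r)

  meld-comm : ∀ {x y σ τ} → Spine x σ → Spine y τ → Interleave σ τ → meld m x y ≡ meld m y x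
  meld-comm {y = y} leaf     _    _ = meld-leaf-comm y
  meld-comm {x = x} (node _) leaf _ = sym (meld-leaf-comm x)
  meld-comm {node l a r} {y} sx@(node sr) sy@(node _) I = begin
    meld m (node l a r) y  ≡⟨ meld-root (spines-le-min sx sy (proj₁ (I 0))) ⟩
    bal m l a (meld m r y) ≡⟨ cong (bal m l a) (meld-comm sy sr (interleave-swap I)) ⟨
    bal m l a (meld m y r) ≡⟨ meld-> (proj₁ (I 0)) ⟨
    meld m y (node l a r)  ∎
    where open ≡-Reasoning

  meld-two-roots : ∀ {xl a xr yl b yr σ τ} → Spine (node xl a xr) σ → Spine (node yl b yr) τ → Interleave σ τ →
                   m yl ≤ m (meld m xr yr) → m xl ≤ m (node (meld m xr yr) b yl) →
                   meld m (node xl a xr) (node yl b yr) ≡ node (node (meld m xr yr) b yl) a xl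
  meld-two-roots {xl} {a} {xr} {yl} {b} {yr} sx sy I yl≤ xl≤ =
    root-stays {xl} {a} {xr} (spines-le-min sx sy (proj₁ (I 0))) xr∪y xl≤
    where
      xr∪y : meld m xr (node yl b yr) ≡ node (meld m xr yr) b yl
      xr∪y = begin
        meld m xr (node yl b yr) ≡⟨ meld-comm sy (spine-tail sx) (interleave-swap I) ⟨
        meld m (node yl b yr) xr ≡⟨ root-stays {yl} {b} {yr} (spines-le-min sy (spine-tail sx) (proj₂ (I 0)))
                                      (sym (meld-comm (spine-tail sx) (spine-tail sy) (interleave-tail I))) yl≤ ⟩
        node (meld m xr yr) b yl ∎
        where open ≡-Reasoning

-- Fibonacci trees

-- Fibʳ n is inhabited only for even n, and Fibˡ n only for odd n ≥ 3.
data Fib : ℕ → Tree → Set where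
  leaf₀ : Fib 0 leaf
  leaf₁ : Fib 1 leaf
  node  : ∀ {n l a r} → Fib (suc n) l → Fib n r → Fib (2 + n) (node l a r)

data Fibʳ : ℕ → Tree → Set where
  leaf : Fibʳ 0 leaf
  node : ∀ {n l a r} → Fib n l → Fibʳ n r → Fibʳ (2 + n) (node l a r)

data Fibˡ : ℕ → Tree → Set where
  node : ∀ {n l a r} → Fibʳ (2 + n) l → Fib n r → Fibˡ (3 + n) (node l a r)

size-Fib : ∀ {n t} → Fib n t → size t ≡ fib (suc n)
size-Fib leaf₀ = refl
size-Fib leaf₁ = refl
size-Fib (node {n} {l} {a} {r} lF rF) = begin
  size (node l a r)         ≡⟨ size-node l a r ⟩
  size l + size r           ≡⟨ cong₂ _+_ (size-Fib lF) (size-Fib rF) ⟩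
  fib (2 + n) + fib (suc n) ≡⟨ +-comm (fib (2 + n)) _ ⟩
  fib (3 + n)               ∎
  where open ≡-Reasoning

size-Fibʳ : ∀ {n t} → Fibʳ n t → size t ≡ suc (fib n)
size-Fibʳ leaf = refl
size-Fibʳ (node {n} {l} {a} {r} lF rFʳ) = begin
  size (node l a r)         ≡⟨ size-node l a r ⟩
  size l + size r           ≡⟨ cong₂ _+_ (size-Fib lF) (size-Fibʳ rFʳ) ⟩
  fib (suc n) + suc (fib n) ≡⟨ +-suc (fib (suc n)) _ ⟩
  suc (fib (suc n) + fib n) ≡⟨ cong suc (+-comm (fib (suc n)) _) ⟩
  suc (fib (2 + n))         ∎
  where open ≡-Reasoning

size-Fibˡ : ∀ {n t} → Fibˡ n t → size t ≡ suc (fib n)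
size-Fibˡ (node {n} {l} {a} {r} lFʳ rF) = begin
  size (node l a r)               ≡⟨ size-node l a r ⟩
  size l + size r                 ≡⟨ cong₂ _+_ (size-Fibʳ lFʳ) (size-Fib rF) ⟩
  suc (fib (2 + n) + fib (suc n)) ≡⟨ cong suc (+-comm (fib (2 + n)) _) ⟩
  suc (fib (3 + n))               ∎
  where open ≡-Reasoning

rank-Fib : ∀ {n t} → Fib n t → rank t ≡ ⌊ n /2⌋
rank-Fib leaf₀       = refl
rank-Fib leaf₁       = refl
rank-Fib (node _ rF) = cong suc (rank-Fib rF)

rank-Fibʳ : ∀ {n t} → Fibʳ n t → rank t ≡ ⌊ n /2⌋
rank-Fibʳ leaf         = refl
rank-Fibʳ (node _ rFʳ) = cong suc (rank-Fibʳ rFʳ)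

rank-Fibˡ : ∀ {n t} → Fibˡ (3 + n) t → rank t ≡ suc ⌊ n /2⌋
rank-Fibˡ (node _ rF) = cong suc (rank-Fib rF)

⌊n*2/2⌋≡n : ∀ n → ⌊ n * 2 /2⌋ ≡ n
⌊n*2/2⌋≡n zero    = refl
⌊n*2/2⌋≡n (suc n) = cong suc (⌊n*2/2⌋≡n n)

-- These are the only comparisons that the rebalancing makes in the melds below.
record ShapeMonotone (m : Tree → ℕ) : Set where
  field
    Fib≤Fib  : ∀ {n a b} → Fib n a → Fib (suc n) b → m a ≤ m b
    Fibʳ≤Fib : ∀ {n a b} → Fibʳ n a → Fib n b → m a ≤ m b
    Fib≤Fibʳ : ∀ {n a b} → Fib n a → Fibʳ (2 + n) b → m a ≤ m b

weight-monotone : ShapeMonotone weight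
weight-monotone = record
  { Fib≤Fib  = λ {n} {a} {b} aF bF → by-sizes a b (size-Fib aF) (size-Fib bF) (fib-≤-suc (suc n))
  ; Fibʳ≤Fib = Fibʳ≤Fib
  ; Fib≤Fibʳ = λ {n} {a} {b} aF bFʳ →
      by-sizes a b (size-Fib aF) (size-Fibʳ bFʳ) (m≤n⇒m≤1+n (fib-≤-suc (suc n)))
  }
  where
    by-sizes : ∀ a b {i j} → size a ≡ i → size b ≡ j → i ≤ j → weight a ≤ weight b
    by-sizes a b refl refl i≤j = s≤s⁻¹ i≤j
    Fibʳ≤Fib : ∀ {n a b} → Fibʳ n a → Fib n b → weight a ≤ weight b
    Fibʳ≤Fib leaf _ = z≤n
    Fibʳ≤Fib {a = a} {b} aFʳ@(node {n} _ _) bF =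
      by-sizes a b (size-Fibʳ aFʳ) (size-Fib bF) (+-monoˡ-≤ (fib (2 + n)) (fib-mono {1} {suc n} (s≤s z≤n)))

rank-monotone : ShapeMonotone rank
rank-monotone = record
  { Fib≤Fib  = λ {n} aF bF → by-ranks (rank-Fib aF) (rank-Fib bF) (⌊n/2⌋-mono (n≤1+n n))
  ; Fibʳ≤Fib = λ aFʳ bF → by-ranks (rank-Fibʳ aFʳ) (rank-Fib bF) ≤-refl
  ; Fib≤Fibʳ = λ aF bFʳ → by-ranks (rank-Fib aF) (rank-Fibʳ bFʳ) (n≤1+n _)
  }
  where
    by-ranks : ∀ {a b i j} → rank a ≡ i → rank b ≡ j → i ≤ j → rank a ≤ rank b
    by-ranks refl refl i≤j = i≤j

module _ (m : Tree → ℕ) where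

  union-cost : ∀ k {x y} → size x ≡ suc (fib (3 + k)) → size y ≡ suc (fib (2 + k)) → rank x + rank y ≡ 2 + k →
               CostOK c (size x + size y) (meldCost m x y)
  union-cost k {x} {y} sx sy rxy = subst₂ (CostOK c) sizes (sym (trans (meldCost≡rank+rank m x y) rxy)) (fib-cost k)
    where
      add : ∀ u v → v + u + 2 ≡ suc u + suc v
      add = solve-∀
      sizes : fib (4 + k) + 2 ≡ size x + size y
      sizes = trans (add (fib (3 + k)) (fib (2 + k))) (sym (cong₂ _+_ sx sy))

  cost-Fibˡ-Fibʳ : ∀ j {x y} → Fibˡ (3 + j * 2) x → Fibʳ (2 + j * 2) y → CostOK c (size x + size y) (meldCost m x y)
  cost-Fibˡ-Fibʳ j {x} {y} xFˡ yFʳ = union-cost (j * 2) {x} {y} (size-Fibˡ xFˡ) (size-Fibʳ yFʳ) (begin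
    rank x + rank y                   ≡⟨ cong₂ _+_ (rank-Fibˡ xFˡ) (rank-Fibʳ yFʳ) ⟩
    suc ⌊ j * 2 /2⌋ + suc ⌊ j * 2 /2⌋ ≡⟨ cong (λ i → suc i + suc i) (⌊n*2/2⌋≡n j) ⟩
    suc j + suc j                     ≡⟨ double j ⟩
    2 + j * 2                         ∎)
    where
      open ≡-Reasoning
      double : ∀ i → suc i + suc i ≡ 2 + i * 2
      double = solve-∀

  cost-Fibʳ-Fibˡ : ∀ j {x y} → Fibʳ (4 + j * 2) x → Fibˡ (3 + j * 2) y → CostOK c (size x + size y) (meldCost m x y)
  cost-Fibʳ-Fibˡ j {x} {y} xFʳ yFˡ = union-cost (1 + j * 2) {x} {y} (size-Fibʳ xFʳ) (size-Fibˡ yFˡ) (begin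
    rank x + rank y                   ≡⟨ cong₂ _+_ (rank-Fibʳ xFʳ) (rank-Fibˡ yFˡ) ⟩
    2 + ⌊ j * 2 /2⌋ + suc ⌊ j * 2 /2⌋ ≡⟨ cong (λ i → 2 + i + suc i) (⌊n*2/2⌋≡n j) ⟩
    2 + j + suc j                     ≡⟨ double+1 j ⟩
    3 + j * 2                         ∎)
    where
      open ≡-Reasoning
      double+1 : ∀ i → 2 + i + suc i ≡ 3 + i * 2
      double+1 = solve-∀

  -- 4 ≤ φ^(7/2), checked as 16 ≤ φ⁷ = 8 + 13φ.
  cost-singles : ∀ {x y} → Fibʳ 2 x → Fibʳ 2 y → CostOK c (size x + size y) (meldCost m x y)
  cost-singles {node leaf a leaf} {node leaf b leaf} (node leaf₀ leaf) (node leaf₀ leaf) =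
    subst (CostOK c 4) (sym (meldCost≡rank+rank m (node leaf a leaf) (node leaf b leaf))) (≤ᵇ⇒≤ 9 845 tt)

-- Labels

Increasing : (ℕ → ℕ) → Set
Increasing h = h Preserves _<ℕ_ ⟶ _<ℕ_

evens odds : (ℕ → ℕ) → ℕ → ℕ
evens h i = h (i * 2)
odds  h i = h (suc (i * 2))

left : Tree → Tree
left leaf         = leaf
left (node l _ _) = l

Labelled : (ℕ → ℕ) → Tree → Set
Labelled h t = Spine t (evens h) × Spine (left t) (odds h)

-- To build meld x y labelled by h, label x by h ∘ firstLabel and y by h ∘ secondLabel.  Their
-- right spines then alternate as h 0 < h 1 < h 3 < h 4 < h 5 < …, and the right spines of their
-- left subtrees continue the two spines required of the result (see labelled-two-roots).
firstLabel secondLabel : ℕ → ℕ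
firstLabel zero     = 0
firstLabel (suc n)  = 2 + n
secondLabel zero    = 1
secondLabel (suc n) = 3 + n

firstLabel-increasing : Increasing firstLabel
firstLabel-increasing {zero}  {suc _} _         = s≤s z≤n
firstLabel-increasing {suc _} {suc _} (s≤s m<n) = s≤s (s≤s m<n)

secondLabel-increasing : Increasing secondLabel
secondLabel-increasing {zero}  {suc _} _         = s≤s (s≤s z≤n)
secondLabel-increasing {suc _} {suc _} (s≤s m<n) = s≤s (s≤s (s≤s m<n))

interleave-labels : ∀ {h} → Increasing h → Interleave (evens (h ∘ firstLabel)) (evens (h ∘ secondLabel))
interleave-labels h↑ i = h↑ (first<second (i * 2)) , h↑ (second<first (i * 2))
  where
    first<second : ∀ n → firstLabel n <ℕ secondLabel n
    first<second zero    = s≤s z≤n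
    first<second (suc n) = n<1+n (2 + n)
    second<first : ∀ n → secondLabel n <ℕ firstLabel (2 + n)
    second<first zero    = s≤s (s≤s z≤n)
    second<first (suc n) = n<1+n (3 + n)

labelled-single : ∀ h → Labelled h (node leaf (h 0) leaf)
labelled-single h = node leaf , leaf

labelled-two-roots : ∀ {h xl a xr yl b yr} R →
                     Labelled (h ∘ firstLabel) (node xl a xr) → Labelled (h ∘ secondLabel) (node yl b yr) →
                     Labelled h (node (node R b yl) a xl)
labelled-two-roots R (node _ , sxl) (node _ , syl) = node sxl , node syl

module _ (m : Tree → ℕ) (mono : ShapeMonotone m) where
  open ShapeMonotone mono

  meld-Fibʳ-Fib : ∀ {n x y σ τ} → Fibʳ (2 + n) x → Fib n y → Spine x σ → Spine y τ → Interleave σ τ →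
                  Fib (2 + n) (meld m x y)
  meld-Fibʳ-Fib {x = node leaf a leaf} (node leaf₀ leaf) leaf₀ _ _ _ =
    subst (Fib 2) (sym (root-stays m {leaf} {a} {leaf} {leaf} tt refl ≤-refl)) (node leaf₁ leaf₀)
  meld-Fibʳ-Fib (node _ ()) leaf₁
  meld-Fibʳ-Fib (node xlF xrFʳ) (node ylF yrF) sx sy I =
    subst (Fib _) (sym (meld-two-roots m sx sy I (Fib≤Fib ylF R) (Fib≤Fib xlF (node R ylF)))) (node (node R ylF) xlF)
    where R = meld-Fibʳ-Fib xrFʳ yrF (spine-tail sx) (spine-tail sy) (interleave-tail I)

  meld-Fib-Fibʳ : ∀ {n x y σ τ} → Fib n x → Fibʳ n y → Spine x σ → Spine y τ → Interleave σ τ →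
                  Fib (suc n) (meld m x y)
  meld-Fib-Fibʳ leaf₀ leaf _ _ _ = leaf₁
  meld-Fib-Fibʳ leaf₁ ()
  meld-Fib-Fibʳ (node xlF xrF) (node ylF yrFʳ) sx sy I =
    subst (Fib _) (sym (meld-two-roots m sx sy I (Fib≤Fib ylF R) (Fib≤Fib xlF (node R ylF)))) (node (node R ylF) xlF)
    where R = meld-Fib-Fibʳ xrF yrFʳ (spine-tail sx) (spine-tail sy) (interleave-tail I)

  meld-labelled : ∀ (S : Tree → Set) h {xl a xr yl b yr} → Increasing h →
                  Labelled (h ∘ firstLabel) (node xl a xr) → Labelled (h ∘ secondLabel) (node yl b yr) →
                  m yl ≤ m (meld m xr yr) → m xl ≤ m (node (meld m xr yr) b yl) →
                  S (node (node (meld m xr yr) b yl) a xl) →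
                  (S ∩ Labelled h) (meld m (node xl a xr) (node yl b yr))
  meld-labelled S h {xr = xr} {yr = yr} h↑ lx ly yl≤ xl≤ s =
    subst (S ∩ Labelled h) (sym (meld-two-roots m (proj₁ lx) (proj₁ ly) (interleave-labels h↑) yl≤ xl≤))
          (s , labelled-two-roots {h} (meld m xr yr) lx ly)

  meld-Fibˡ-Fibʳ : ∀ {n h x y} → Increasing h →
                   (Fibˡ (3 + n) ∩ Labelled (h ∘ firstLabel)) x → (Fibʳ (2 + n) ∩ Labelled (h ∘ secondLabel)) y →
                   (Fibʳ (4 + n) ∩ Labelled h) (meld m x y)
  meld-Fibˡ-Fibʳ {n} {h} h↑ (node xlFʳ xrF , lx) (node ylF yrFʳ , ly) =
    meld-labelled (Fibʳ (4 + n)) h h↑ lx ly (Fib≤Fib ylF R) (Fibʳ≤Fib xlFʳ (node R ylF)) (node (node R ylF) xlFʳ)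
    where
      R = meld-Fib-Fibʳ xrF yrFʳ (spine-tail (proj₁ lx)) (spine-tail (proj₁ ly))
                        (interleave-tail (interleave-labels h↑))

  meld-Fibʳ-Fibˡ : ∀ {n h x y} → Increasing h →
                   (Fibʳ (4 + n) ∩ Labelled (h ∘ firstLabel)) x → (Fibˡ (3 + n) ∩ Labelled (h ∘ secondLabel)) y →
                   (Fibˡ (5 + n) ∩ Labelled h) (meld m x y)
  meld-Fibʳ-Fibˡ {n} {h} h↑ (node xlF xrFʳ , lx) (node ylFʳ yrF , ly) =
    meld-labelled (Fibˡ (5 + n)) h h↑ lx ly (Fibʳ≤Fib ylFʳ R) (Fib≤Fibʳ xlF (node R ylFʳ)) (node (node R ylFʳ) xlF)
    where
      R = meld-Fibʳ-Fib xrFʳ yrF (spine-tail (proj₁ lx)) (spine-tail (proj₁ ly))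
                        (interleave-tail (interleave-labels h↑))

  meld-singles : ∀ {h x y} → Increasing h →
                 (Fibʳ 2 ∩ Labelled (h ∘ firstLabel)) x → (Fibʳ 2 ∩ Labelled (h ∘ secondLabel)) y →
                 (Fibˡ 3 ∩ Labelled h) (meld m x y)
  meld-singles {h} h↑ (node leaf₀ leaf , lx) (yFʳ@(node leaf₀ leaf) , ly) =
    meld-labelled (Fibˡ 3) h h↑ lx ly ≤-refl (Fib≤Fibʳ leaf₀ yFʳ) (node yFʳ leaf₀)

-- Good runs

record Extension (m : Tree → ℕ) (hs₀ : List Tree) (P : Tree → Set) : Set where
  field
    heaps    : List Tree
    run      : GoodRun m c heaps
    extends  : hs₀ ⊆ heaps
    heap     : Tree
    heap∈    : heap ∈ heaps
    property : P heap

extend-by-single : ∀ {m hs₀} {P : Tree → Set} → GoodRun m c hs₀ → ∀ a → P (node leaf a leaf) →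
                   Extension m hs₀ P
extend-by-single {hs₀ = hs₀} r a p = record
  { heaps    = node leaf a leaf ∷ hs₀
  ; run      = single r a
  ; extends  = there
  ; heap     = node leaf a leaf
  ; heap∈    = here refl
  ; property = p
  }

extend-by-union : ∀ {m hs₀} {P Q R : Tree → Set} →
                  Extension m hs₀ P → (∀ {hs} → GoodRun m c hs → Extension m hs Q) →
                  (∀ {x y} → P x → Q y → CostOK c (size x + size y) (meldCost m x y) × R (meld m x y)) →
                  Extension m hs₀ R
extend-by-union {m} e₁ extend₂ step = record
  { heaps    = meld m x y ∷ heaps e₂
  ; run      = union (run e₂) (extends e₂ (heap∈ e₁)) (heap∈ e₂) (proj₁ (step (property e₁) (property e₂)))
  ; extends  = there ∘ extends e₂ ∘ extends e₁
  ; heap     = meld m x y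
  ; heap∈    = here refl
  ; property = proj₂ (step (property e₁) (property e₂))
  }
  where
    open Extension
    e₂ = extend₂ (run e₁)
    x  = heap e₁
    y  = heap e₂

module _ (m : Tree → ℕ) (mono : ShapeMonotone m) where

  mutual
    build-Fibʳ : ∀ j h → Increasing h → ∀ {hs} → GoodRun m c hs →
                 Extension m hs (Fibʳ (2 + j * 2) ∩ Labelled h)
    build-Fibʳ zero    h _  r = extend-by-single r (h 0) (node leaf₀ leaf , labelled-single h)
    build-Fibʳ (suc j) h h↑ r =
      extend-by-union (build-Fibˡ j (h ∘ firstLabel) (h↑ ∘ firstLabel-increasing) r)
                      (build-Fibʳ j (h ∘ secondLabel) (h↑ ∘ secondLabel-increasing))
                      (λ px py → cost-Fibˡ-Fibʳ m j (proj₁ px) (proj₁ py) , meld-Fibˡ-Fibʳ m mono h↑ px py)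

    build-Fibˡ : ∀ j h → Increasing h → ∀ {hs} → GoodRun m c hs →
                 Extension m hs (Fibˡ (3 + j * 2) ∩ Labelled h)
    build-Fibˡ zero    h h↑ r =
      extend-by-union (build-Fibʳ zero (h ∘ firstLabel) (h↑ ∘ firstLabel-increasing) r)
                      (build-Fibʳ zero (h ∘ secondLabel) (h↑ ∘ secondLabel-increasing))
                      (λ px py → cost-singles m (proj₁ px) (proj₁ py) , meld-singles m mono h↑ px py)
    build-Fibˡ (suc j) h h↑ r =
      extend-by-union (build-Fibʳ (suc j) (h ∘ firstLabel) (h↑ ∘ firstLabel-increasing) r)
                      (build-Fibˡ j (h ∘ secondLabel) (h↑ ∘ secondLabel-increasing))
                      (λ px py → cost-Fibʳ-Fibˡ m j (proj₁ px) (proj₁ py) , meld-Fibʳ-Fibˡ m mono h↑ px py)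

  arbitrarily-large : ArbitrarilyLarge m c
  arbitrarily-large N = heaps , run , heap , heap∈ , N≤size
    where
      open Extension (build-Fibʳ N id id start)
      N≤size : N ≤ size heap
      N≤size = begin
        N           ≤⟨ n≤1+n N ⟩
        suc N       ≡⟨ trans (rank-Fibʳ (proj₁ property)) (cong suc (⌊n*2/2⌋≡n N)) ⟨
        rank heap   ≤⟨ rank≤weight heap ⟩
        weight heap ≤⟨ n≤1+n _ ⟩
        size heap   ∎
        where open ≤-Reasoning

theorem2 : ∃[ c ] (c < + 2 / 1 × ArbitrarilyLarge weight c × ArbitrarilyLarge rank c)
theorem2 = c , c<2 , arbitrarily-large weight weight-monotone , arbitrarily-large rank rank-monotone
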